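{- Let $T$ be an arbitrary theory (set of formulas of $\mathsf{SE}$) and $F$ a formula. If $T \Vdash F$, then $T \vdash_{\mathsf{SE}} F$.
   Context: Syntax of $\mathsf{SE}$. There are countably infinite sets of justification constants $\mathsf{JConst}=\{0,1,c_1,c_2,\dots\}$ (with two distinguished constants $0,1$) and justification variables $\mathsf{JVar}=\{x_1,x_2,\dots\}$. Terms: every constant and every variable is a term; if $s,t$ are terms then so are $s\cdot t$ and $s+t$. Formulas are built from $\bot$, atomic propositions $P$ from a countable set $\mathsf{Prop}$, implication $A\to B$, and $t:A$ for a term $t$ and formula $A$; $\neg,\wedge,\vee,\leftrightarrow$ are the usual abbreviations. $A[w/t]$ denotes the result of simultaneously replacing all occurrences of the variable $w$ in $A$ by the term $t$. Axioms of $\mathsf{SE}$ (for arbitrary formulas $A,B$ and variables $w,x,y,z$): (CL) all instances of propositional tautologies; (j) $x:(A\to B)\to(y:A\to x\cdot y:B)$; (j+) $x:A\wedge y:A\to(x+y):A$; (a+) $A[w/(x+y)+z]\to A[w/x+(y+z)]$; (c+) $A[w/x+y]\to A[w/y+x]$; (0+) $A[w/x+0]\leftrightarrow A[w/x]$; (am) $A[w/(x\cdot y)\cdot z]\leftrightarrow A[w/x\cdot(y\cdot z)]$; (a0) $A[w/x\cdot 0]\leftrightarrow A[w/0]$ and $A[w/0\cdot x]\leftrightarrow A[w/0]$; (a1) $A[w/x\cdot 1]\leftrightarrow A[w/x]$ and $A[w/1\cdot x]\leftrightarrow A[w/x]$; (dl) $A[w/x\cdot(y+z)]\leftrightarrow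 A[w/x\cdot y+x\cdot z]$; (dr) $A[w/(y+z)\cdot x]\leftrightarrow A[w/y\cdot x+z\cdot x]$. Rules: modus ponens and (jv): from $A$ infer $A[x/t]$ for any variable $x$ and term $t$. A theory is a set $T$ of formulas; $T\vdash_{\mathsf{SE}}F$ means $F$ has a derivation using axioms, members of $T$, and the two rules. Semantics. A semiring $K=(S,+,\cdot,0,1)$ satisfies: $+$ associative and commutative with neutral $0$; $\cdot$ associative with neutral $1$ (not necessarily commutative); both distributive laws; $a\cdot 0=0\cdot a=0$. An interpretation is a map $I:\mathsf{JConst}\to S$ with $I(0)=0$, $I(1)=1$; a valuation is a map $v:\mathsf{JVar}\to S$. For a term $t$, $t_I^v\in S$ is defined by $c_I^v=I(c)$, $x_I^v=v(x)$, $(s+t)_I^v=s_I^v+t_I^v$, $(s\cdot t)_I^v=s_I^v\cdot t_I^v$. $\mathsf{Fml}_S$ is the set of formulas built like ordinary formulas but with elements of $S$ in place of terms; $A_I^v\in\mathsf{Fml}_S$ replaces each term $t$ in $A$ by $t_I^v$. An evidence relation is $J\subseteq S\times \mathsf{Fml}_S$ such that $J(s,A\to B)$ and $J(t,A)$ imply $J(s\cdot t,B)$, and $J(s,A)$ and $J(t,A)$ imply $J(s+t,A)$. A semiring model is $M=(K,*,I,J)$ with $K$ a semiring, $*:\mathsf{Prop}\to\{\mathbb F,\mathbb T\}$, $I$ an interpretation, $J$ an evidence relation. Truth: $M,v\not\Vdash\bot$; $M,v\Vdash P$ iff $P^*=\mathbb T$; $M,v\Vdash A\to B$ iff $M,v\not\Vdash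 A$ or $M,v\Vdash B$; $M,v\Vdash s:A$ iff $J(s_I^v,A_I^v)$. $M\Vdash A$ iff $M,v\Vdash A$ for all valuations $v$; $M\Vdash T$ iff $M\Vdash A$ for all $A\in T$. $T\Vdash F$ iff every semiring model $M$ with $M\Vdash T$ satisfies $M\Vdash F$. -}

module Defs where

open import Data.Nat using (ℕ)
open import Data.Bool using (Bool; true; false; not; _∨_)
open import Data.Empty using (⊥)
open import Relation.Nullary using (Dec; yes; no)
open import Relation.Binary.PropositionalEquality using (_≡_)
open import Algebra.Structures using (IsSemiring)

data JConst : Set where
  c0 : JConst
  c1 : JConst
  c  : ℕ → JConst

JVar : Set
JVar = ℕ

PropVar : Set
PropVar = ℕ

infixl 7 _·_
infixl 6 _⊕_

data Term : Set where
  con : JConst → Term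
  var : JVar → Term
  _·_ : Term → Term → Term
  _⊕_ : Term → Term → Term

-- Formulas whose "justification slots" hold elements of an arbitrary set S.
-- Fml = FmlG Term are the formulas of SE; FmlG S is Fml_S of the paper.
infixr 2 _⇒_
infixr 5 _∶_

data FmlG (S : Set) : Set where
  ⊥'   : FmlG S
  atom : PropVar → FmlG S
  _⇒_  : FmlG S → FmlG S → FmlG S
  _∶_  : S → FmlG S → FmlG S

Fml : Set
Fml = FmlG Term

¬' : ∀ {S} → FmlG S → FmlG S
¬' A = A ⇒ ⊥'

infixr 4 _∧'_
infixr 3 _∨'_
infix 1 _⇔'_

_∧'_ : ∀ {S} → FmlG S → FmlG S → FmlG S
A ∧' B = ¬' (A ⇒ ¬' B)

_∨'_ : ∀ {S} → FmlG S → FmlG S → FmlG S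
A ∨' B = ¬' A ⇒ B

_⇔'_ : ∀ {S} → FmlG S → FmlG S → FmlG S
A ⇔' B = (A ⇒ B) ∧' (B ⇒ A)

mapF : ∀ {S S' : Set} → (S → S') → FmlG S → FmlG S'
mapF f ⊥'       = ⊥'
mapF f (atom p) = atom p
mapF f (A ⇒ B)  = mapF f A ⇒ mapF f B
mapF f (s ∶ A)  = f s ∶ mapF f A

substT : JVar → Term → Term → Term
substT w t (con k) = con k
substT w t (var x) with x Data.Nat.≟ w
... | yes _ = t
... | no  _ = var x
  where import Data.Nat
substT w t (s₁ · s₂) = substT w t s₁ · substT w t s₂
substT w t (s₁ ⊕ s₂) = substT w t s₁ ⊕ substT w t s₂

_[_≔_] : Fml → JVar → Term → Fml
A [ w ≔ t ] = mapF (substT w t) A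

evalPL : (Fml → Bool) → Fml → Bool
evalPL f ⊥'       = false
evalPL f (atom p) = f (atom p)
evalPL f (A ⇒ B)  = not (evalPL f A) ∨ evalPL f B
evalPL f (s ∶ A)  = f (s ∶ A)

Tautology : Fml → Set
Tautology A = (f : Fml → Bool) → evalPL f A ≡ true

𝟘 𝟙 : Term
𝟘 = con c0
𝟙 = con c1

data Axiom : Fml → Set where
  CL   : ∀ {A} → Tautology A → Axiom A
  ax-j : ∀ (x y : JVar) (A B : Fml) →
         Axiom (var x ∶ (A ⇒ B) ⇒ (var y ∶ A ⇒ var x · var y ∶ B))
  ax-j+ : ∀ (x y : JVar) (A : Fml) →
         Axiom (var x ∶ A ∧' var y ∶ A ⇒ (var x ⊕ var y) ∶ A)
  ax-a+ : ∀ (A : Fml) (w x y z : JVar) →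
         Axiom (A [ w ≔ (var x ⊕ var y) ⊕ var z ] ⇒ A [ w ≔ var x ⊕ (var y ⊕ var z) ])
  ax-c+ : ∀ (A : Fml) (w x y : JVar) →
         Axiom (A [ w ≔ var x ⊕ var y ] ⇒ A [ w ≔ var y ⊕ var x ])
  ax-0+ : ∀ (A : Fml) (w x : JVar) →
         Axiom (A [ w ≔ var x ⊕ 𝟘 ] ⇔' A [ w ≔ var x ])
  ax-am : ∀ (A : Fml) (w x y z : JVar) →
         Axiom (A [ w ≔ (var x · var y) · var z ] ⇔' A [ w ≔ var x · (var y · var z) ])
  ax-a0r : ∀ (A : Fml) (w x : JVar) →
         Axiom (A [ w ≔ var x · 𝟘 ] ⇔' A [ w ≔ 𝟘 ])
  ax-a0l : ∀ (A : Fml) (w x : JVar) →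
         Axiom (A [ w ≔ 𝟘 · var x ] ⇔' A [ w ≔ 𝟘 ])
  ax-a1r : ∀ (A : Fml) (w x : JVar) →
         Axiom (A [ w ≔ var x · 𝟙 ] ⇔' A [ w ≔ var x ])
  ax-a1l : ∀ (A : Fml) (w x : JVar) →
         Axiom (A [ w ≔ 𝟙 · var x ] ⇔' A [ w ≔ var x ])
  ax-dl : ∀ (A : Fml) (w x y z : JVar) →
         Axiom (A [ w ≔ var x · (var y ⊕ var z) ] ⇔' A [ w ≔ var x · var y ⊕ var x · var z ])
  ax-dr : ∀ (A : Fml) (w x y z : JVar) →
         Axiom (A [ w ≔ (var y ⊕ var z) · var x ] ⇔' A [ w ≔ var y · var x ⊕ var z · var x ])

Theory : Set₁
Theory = Fml → Set

infix 0 _⊢_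

data _⊢_ (T : Theory) : Fml → Set where
  ax  : ∀ {A} → Axiom A → T ⊢ A
  hyp : ∀ {A} → T A → T ⊢ A
  mp  : ∀ {A B} → T ⊢ A ⇒ B → T ⊢ A → T ⊢ B
  jv  : ∀ {A} (x : JVar) (t : Term) → T ⊢ A → T ⊢ A [ x ≔ t ]

record SemiringModel : Set₁ where
  field
    S          : Set
    _+ₛ_       : S → S → S
    _*ₛ_       : S → S → S
    0ₛ         : S
    1ₛ         : S
    isSemiring : IsSemiring _≡_ _+ₛ_ _*ₛ_ 0ₛ 1ₛ
    star       : PropVar → Bool
    I          : JConst → S
    I-0        : I c0 ≡ 0ₛ
    I-1        : I c1 ≡ 1ₛ
    J          : S → FmlG S → Set
    J-app      : ∀ {s t A B} → J s (A ⇒ B) → J t A → J (s *ₛ t) B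
    J-sum      : ∀ {s t A} → J s A → J t A → J (s +ₛ t) A

module _ (M : SemiringModel) where
  open SemiringModel M

  Valuation : Set
  Valuation = JVar → S

  ⟦_⟧ : Term → Valuation → S
  ⟦ con k ⟧ v = I k
  ⟦ var x ⟧ v = v x
  ⟦ s · t ⟧ v = ⟦ s ⟧ v *ₛ ⟦ t ⟧ v
  ⟦ s ⊕ t ⟧ v = ⟦ s ⟧ v +ₛ ⟦ t ⟧ v

  Sat : Valuation → Fml → Set
  Sat v ⊥'       = ⊥
  Sat v (atom p) = star p ≡ true
  Sat v (A ⇒ B)  = Sat v A → Sat v B
  Sat v (t ∶ A)  = J (⟦ t ⟧ v) (mapF (λ u → ⟦ u ⟧ v) A)

  Valid : Fml → Set
  Valid A = (v : Valuation) → Sat v A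

infix 0 _⊩_
_⊩_ : Theory → Fml → Set₁
T ⊩ F = (M : SemiringModel) → (∀ A → T A → Valid M A) → Valid M F

-- Henkin-style completeness. If T ⊬ F, excluded middle extends T ∪ {¬F}, along an enumeration
-- of all formulas, to a maximal consistent set Γ. Two terms are identified when each may replace
-- the other in every formula provably from T; the axioms (a+)…(dr), instantiated through the
-- substitution rule (jv), make this congruence satisfy the semiring laws, so the classes of terms
-- (represented by their least-coded members) form a semiring. Taking t as evidence for A exactly
-- when t : A ∈ Γ, the axioms (j) and (j+) are the closure conditions of an evidence relation, and
-- the truth lemma shows that this model validates T but not F.

module Submission where

open import Defs
open import Level using (0ℓ)
open import Axiom.ExcludedMiddle using (ExcludedMiddle)
open import Algebra.Structures using (IsSemiring)
open import Data.Bool using (true; false)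
open import Data.Empty using (⊥-elim)
open import Data.List using (List; []; _∷_)
open import Data.Nat using (ℕ; zero; suc; _+_; _≤_; _<_; _⊔_; _≟_; _<?_; z≤n; s≤s; s≤s⁻¹)
open import Data.Nat.Properties
  using ( ≤-refl; ≤-reflexive; ≤-antisym; <-irrefl; <-cmp; ≤-<-trans; <-≤-trans; ≮⇒≥; <⇒≢
        ; m<n⇒m<1+n; m≤n⇒m<n∨m≡n; m≤m+n; +-cancelˡ-≡
        ; m≤m⊔n; m≤n⊔m; m≤n⇒m≤n⊔o; m≤n⇒m≤o⊔n; m⊔n<o⇒m<o; m⊔n<o⇒n<o )
open import Data.Nat.Binary using (ℕᵇ; 2[1+_]; 1+[2_]; toℕ) renaming (zero to zeroᵇ)
open import Data.Nat.Binary.Properties using (toℕ-injective)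
open import Data.Product using (Σ-syntax; _×_; _,_; proj₁; proj₂)
open import Data.Sum using (_⊎_; inj₁; inj₂)
open import Function using (_∘_)
open import Function.Bundles using (_⇔_; mk⇔; module Equivalence)
open import Relation.Binary.Definitions using (DecidableEquality; tri<; tri≈; tri>)
open import Relation.Binary.Structures using (IsEquivalence)
open import Axiom.UniquenessOfIdentityProofs using (module Decidable⇒UIP)
open import Relation.Binary.PropositionalEquality
  using (_≡_; _≢_; refl; sym; trans; cong; cong₂; subst; isEquivalence)
open import Relation.Nullary using (Dec; yes; no; ¬_)
open import Relation.Nullary.Decidable using (does)

Subst : Set
Subst = JVar → Term

infixl 8 _⟪_⟫ᵗ _⟪_⟫

_⟪_⟫ᵗ : Term → Subst → Term
con k   ⟪ σ ⟫ᵗ = con k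
var x   ⟪ σ ⟫ᵗ = σ x
(s · t) ⟪ σ ⟫ᵗ = s ⟪ σ ⟫ᵗ · t ⟪ σ ⟫ᵗ
(s ⊕ t) ⟪ σ ⟫ᵗ = s ⟪ σ ⟫ᵗ ⊕ t ⟪ σ ⟫ᵗ

_⟪_⟫ : Fml → Subst → Fml
A ⟪ σ ⟫ = mapF (_⟪ σ ⟫ᵗ) A

infixl 9 _⨾_

_⨾_ : Subst → Subst → Subst
(σ ⨾ τ) i = σ i ⟪ τ ⟫ᵗ

infixl 10 _[_↦_]

_[_↦_] : Subst → JVar → Term → Subst
(σ [ w ↦ s ]) i with i ≟ w
... | yes _ = s
... | no  _ = σ i

⟨_↦_⟩ : JVar → Term → Subst
⟨ w ↦ s ⟩ = var [ w ↦ s ]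

[↦]-same : ∀ σ w s → (σ [ w ↦ s ]) w ≡ s
[↦]-same σ w s with w ≟ w
... | yes _ = refl
... | no w≢w = ⊥-elim (w≢w refl)

[↦]-other : ∀ σ w s {i} → i ≢ w → (σ [ w ↦ s ]) i ≡ σ i
[↦]-other σ w s {i} i≢w with i ≟ w
... | yes i≡w = ⊥-elim (i≢w i≡w)
... | no  _   = refl

substT-⟨↦⟩ : ∀ w s t → substT w s t ≡ t ⟪ ⟨ w ↦ s ⟩ ⟫ᵗ
substT-⟨↦⟩ w s (con k) = refl
substT-⟨↦⟩ w s (var x) with x ≟ w
... | yes _ = refl
... | no  _ = refl
substT-⟨↦⟩ w s (a · b) = cong₂ _·_ (substT-⟨↦⟩ w s a) (substT-⟨↦⟩ w s b)
substT-⟨↦⟩ w s (a ⊕ b) = cong₂ _⊕_ (substT-⟨↦⟩ w s a) (substT-⟨↦⟩ w s b)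

mapF-∘ : ∀ {X Y Z : Set} (f : Y → Z) (g : X → Y) A → mapF f (mapF g A) ≡ mapF (f ∘ g) A
mapF-∘ f g ⊥'       = refl
mapF-∘ f g (atom p) = refl
mapF-∘ f g (A ⇒ B)  = cong₂ _⇒_ (mapF-∘ f g A) (mapF-∘ f g B)
mapF-∘ f g (s ∶ A)  = cong (f (g s) ∶_) (mapF-∘ f g A)

mapF-id : ∀ {X : Set} (A : FmlG X) → mapF (λ x → x) A ≡ A
mapF-id ⊥'       = refl
mapF-id (atom p) = refl
mapF-id (A ⇒ B)  = cong₂ _⇒_ (mapF-id A) (mapF-id B)
mapF-id (s ∶ A)  = cong (s ∶_) (mapF-id A)

mapF-cong : ∀ {X Y : Set} {f g : X → Y} → (∀ t → f t ≡ g t) → ∀ A → mapF f A ≡ mapF g A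
mapF-cong f≗g ⊥'       = refl
mapF-cong f≗g (atom p) = refl
mapF-cong f≗g (A ⇒ B)  = cong₂ _⇒_ (mapF-cong f≗g A) (mapF-cong f≗g B)
mapF-cong f≗g (s ∶ A)  = cong₂ _∶_ (f≗g s) (mapF-cong f≗g A)

[≔]-⟨↦⟩ : ∀ A w s → A [ w ≔ s ] ≡ A ⟪ ⟨ w ↦ s ⟩ ⟫
[≔]-⟨↦⟩ A w s = mapF-cong (substT-⟨↦⟩ w s) A

maxVarᵗ : Term → ℕ
maxVarᵗ (con _) = 0
maxVarᵗ (var x) = x
maxVarᵗ (s · t) = maxVarᵗ s ⊔ maxVarᵗ t
maxVarᵗ (s ⊕ t) = maxVarᵗ s ⊔ maxVarᵗ t

maxVar : Fml → ℕ
maxVar ⊥'       = 0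
maxVar (atom _) = 0
maxVar (A ⇒ B)  = maxVar A ⊔ maxVar B
maxVar (t ∶ A)  = maxVarᵗ t ⊔ maxVar A

infix 4 _≗_within_

_≗_within_ : Subst → Subst → ℕ → Set
σ ≗ τ within n = ∀ i → i ≤ n → σ i ≡ τ i

within-⊔ˡ : ∀ {σ τ} m n → σ ≗ τ within (m ⊔ n) → σ ≗ τ within m
within-⊔ˡ m n h i i≤m = h i (m≤n⇒m≤n⊔o n i≤m)

within-⊔ʳ : ∀ {σ τ} m n → σ ≗ τ within (m ⊔ n) → σ ≗ τ within n
within-⊔ʳ m n h i i≤n = h i (m≤n⇒m≤o⊔n m i≤n)

⟪⟫ᵗ-cong : ∀ {σ τ} t → σ ≗ τ within maxVarᵗ t → t ⟪ σ ⟫ᵗ ≡ t ⟪ τ ⟫ᵗ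
⟪⟫ᵗ-cong (con k) h = refl
⟪⟫ᵗ-cong (var x) h = h x ≤-refl
⟪⟫ᵗ-cong (a · b) h =
  cong₂ _·_ (⟪⟫ᵗ-cong a (within-⊔ˡ _ _ h)) (⟪⟫ᵗ-cong b (within-⊔ʳ _ _ h))
⟪⟫ᵗ-cong (a ⊕ b) h =
  cong₂ _⊕_ (⟪⟫ᵗ-cong a (within-⊔ˡ _ _ h)) (⟪⟫ᵗ-cong b (within-⊔ʳ _ _ h))

⟪⟫-cong : ∀ {σ τ} A → σ ≗ τ within maxVar A → A ⟪ σ ⟫ ≡ A ⟪ τ ⟫
⟪⟫-cong ⊥'       h = refl
⟪⟫-cong (atom p) h = refl
⟪⟫-cong (A ⇒ B)  h = cong₂ _⇒_ (⟪⟫-cong A (within-⊔ˡ _ _ h)) (⟪⟫-cong B (within-⊔ʳ _ _ h))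
⟪⟫-cong (s ∶ A)  h = cong₂ _∶_ (⟪⟫ᵗ-cong s (within-⊔ˡ _ _ h)) (⟪⟫-cong A (within-⊔ʳ _ _ h))

⟪⟫ᵗ-id : ∀ t → t ⟪ var ⟫ᵗ ≡ t
⟪⟫ᵗ-id (con k) = refl
⟪⟫ᵗ-id (var x) = refl
⟪⟫ᵗ-id (a · b) = cong₂ _·_ (⟪⟫ᵗ-id a) (⟪⟫ᵗ-id b)
⟪⟫ᵗ-id (a ⊕ b) = cong₂ _⊕_ (⟪⟫ᵗ-id a) (⟪⟫ᵗ-id b)

⟪⟫-id : ∀ A → A ⟪ var ⟫ ≡ A
⟪⟫-id A = trans (mapF-cong ⟪⟫ᵗ-id A) (mapF-id A)

⟪⟫ᵗ-∘ : ∀ σ τ t → t ⟪ σ ⟫ᵗ ⟪ τ ⟫ᵗ ≡ t ⟪ σ ⨾ τ ⟫ᵗ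
⟪⟫ᵗ-∘ σ τ (con k) = refl
⟪⟫ᵗ-∘ σ τ (var x) = refl
⟪⟫ᵗ-∘ σ τ (a · b) = cong₂ _·_ (⟪⟫ᵗ-∘ σ τ a) (⟪⟫ᵗ-∘ σ τ b)
⟪⟫ᵗ-∘ σ τ (a ⊕ b) = cong₂ _⊕_ (⟪⟫ᵗ-∘ σ τ a) (⟪⟫ᵗ-∘ σ τ b)

⟪⟫-∘ : ∀ σ τ A → A ⟪ σ ⟫ ⟪ τ ⟫ ≡ A ⟪ σ ⨾ τ ⟫
⟪⟫-∘ σ τ A = trans (mapF-∘ _ _ A) (mapF-cong (⟪⟫ᵗ-∘ σ τ) A)

⟪⟫ᵗ-trivial : ∀ {σ} t → σ ≗ var within maxVarᵗ t → t ⟪ σ ⟫ᵗ ≡ t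
⟪⟫ᵗ-trivial t h = trans (⟪⟫ᵗ-cong t h) (⟪⟫ᵗ-id t)

⟪⟫-trivial : ∀ {σ} A → σ ≗ var within maxVar A → A ⟪ σ ⟫ ≡ A
⟪⟫-trivial A h = trans (⟪⟫-cong A h) (⟪⟫-id A)

⟨↦⟩-fresh : ∀ {n w} s → n < w → ⟨ w ↦ s ⟩ ≗ var within n
⟨↦⟩-fresh {w = w} s n<w i i≤n = [↦]-other var w s (<⇒≢ (≤-<-trans i≤n n<w))

⟪⟫ᵗ-fresh : ∀ {w} t s → maxVarᵗ t < w → t ⟪ ⟨ w ↦ s ⟩ ⟫ᵗ ≡ t
⟪⟫ᵗ-fresh t s fresh = ⟪⟫ᵗ-trivial t (⟨↦⟩-fresh s fresh)

⟪⟫-fresh : ∀ {w} A s → maxVar A < w → A ⟪ ⟨ w ↦ s ⟩ ⟫ ≡ A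
⟪⟫-fresh A s fresh = ⟪⟫-trivial A (⟨↦⟩-fresh s fresh)

⟪⟨↦⟩⟫-⨾ : ∀ A w t {τ} → τ ≗ var within maxVar A → A ⟪ ⟨ w ↦ t ⟩ ⟫ ⟪ τ ⟫ ≡ A ⟪ ⟨ w ↦ t ⟪ τ ⟫ᵗ ⟩ ⟫
⟪⟨↦⟩⟫-⨾ A w t {τ} τ≗var = trans (⟪⟫-∘ _ τ A) (⟪⟫-cong A pointwise)
  where
  pointwise : ⟨ w ↦ t ⟩ ⨾ τ ≗ ⟨ w ↦ t ⟪ τ ⟫ᵗ ⟩ within maxVar A
  pointwise i i≤A with i ≟ w
  ... | yes _ = refl
  ... | no  _ = τ≗var i i≤A

⟪⟨↦⟩⟫-hole : ∀ A w {h} (P : Term → Term) r → maxVar A < h → P (var h) ⟪ ⟨ h ↦ r ⟩ ⟫ᵗ ≡ P r →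
  A ⟪ ⟨ w ↦ P (var h) ⟩ ⟫ ⟪ ⟨ h ↦ r ⟩ ⟫ ≡ A ⟪ ⟨ w ↦ P r ⟩ ⟫
⟪⟨↦⟩⟫-hole A w P r A<h P-hole =
  trans (⟪⟨↦⟩⟫-⨾ A w (P (var _)) (⟨↦⟩-fresh r A<h)) (cong (λ t → A ⟪ ⟨ w ↦ t ⟩ ⟫) P-hole)

⟨_↦_∣_∣_⟩ : JVar → Term → Term → Term → Subst
⟨ n ↦ s ∣ u ∣ r ⟩ = var [ suc (suc n) ↦ r ] [ suc n ↦ u ] [ n ↦ s ]

⟨↦∣∣⟩-fresh : ∀ {m n} s u r → m < n → ⟨ n ↦ s ∣ u ∣ r ⟩ ≗ var within m
⟨↦∣∣⟩-fresh {n = n} s u r m<n i i≤m =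
  trans ([↦]-other (var [ suc (suc n) ↦ r ] [ suc n ↦ u ]) n s (<⇒≢ i<n))
    (trans ([↦]-other (var [ suc (suc n) ↦ r ]) (suc n) u (<⇒≢ (m<n⇒m<1+n i<n)))
      ([↦]-other var (suc (suc n)) r (<⇒≢ (m<n⇒m<1+n (m<n⇒m<1+n i<n)))))
  where
  i<n = ≤-<-trans i≤m m<n

⟨↦∣∣⟩-₀ : ∀ n s u r → ⟨ n ↦ s ∣ u ∣ r ⟩ n ≡ s
⟨↦∣∣⟩-₀ n s u r = [↦]-same _ n s

⟨↦∣∣⟩-₁ : ∀ n s u r → ⟨ n ↦ s ∣ u ∣ r ⟩ (suc n) ≡ u
⟨↦∣∣⟩-₁ n s u r =
  trans ([↦]-other (var [ suc (suc n) ↦ r ] [ suc n ↦ u ]) n s {suc n} (λ ()))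
    ([↦]-same (var [ suc (suc n) ↦ r ]) (suc n) u)

⟨↦∣∣⟩-₂ : ∀ n s u r → ⟨ n ↦ s ∣ u ∣ r ⟩ (suc (suc n)) ≡ r
⟨↦∣∣⟩-₂ n s u r =
  trans ([↦]-other (var [ suc (suc n) ↦ r ] [ suc n ↦ u ]) n s {suc (suc n)} (λ ()))
    (trans ([↦]-other (var [ suc (suc n) ↦ r ]) (suc n) u {suc (suc n)} (λ ()))
      ([↦]-same var (suc (suc n)) r))

Pattern : Set
Pattern = Term → Term → Term → Term

Natural : Pattern → Set
Natural P = ∀ σ a b c → P a b c ⟪ σ ⟫ᵗ ≡ P (a ⟪ σ ⟫ᵗ) (b ⟪ σ ⟫ᵗ) (c ⟪ σ ⟫ᵗ)

infix 6 □⇒_ _⇒□ _∶□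

data Frame : Set where
  □⇒_ : Fml → Frame
  _⇒□ : Fml → Frame
  _∶□ : Term → Frame

Context : Set
Context = List Frame

plug : Context → Fml → Fml
plug []             X = X
plug ((□⇒ B) ∷ K) X = plug K (X ⇒ B)
plug ((A ⇒□) ∷ K) X = plug K (A ⇒ X)
plug ((t ∶□) ∷ K) X = plug K (t ∶ X)

maxVarᶜ : Context → ℕ
maxVarᶜ []             = 0
maxVarᶜ ((□⇒ B) ∷ K) = maxVar B ⊔ maxVarᶜ K
maxVarᶜ ((A ⇒□) ∷ K) = maxVar A ⊔ maxVarᶜ K
maxVarᶜ ((t ∶□) ∷ K) = maxVarᵗ t ⊔ maxVarᶜ K

plug-⟪⟨↦⟩⟫ : ∀ K X {w} s → maxVarᶜ K < w → plug K X ⟪ ⟨ w ↦ s ⟩ ⟫ ≡ plug K (X ⟪ ⟨ w ↦ s ⟩ ⟫)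
plug-⟪⟨↦⟩⟫ []             X s K<w = refl
plug-⟪⟨↦⟩⟫ ((□⇒ B) ∷ K) X s K<w =
  trans (plug-⟪⟨↦⟩⟫ K _ s (m⊔n<o⇒n<o _ _ K<w))
        (cong (λ Y → plug K (_ ⇒ Y)) (⟪⟫-fresh B s (m⊔n<o⇒m<o _ _ K<w)))
plug-⟪⟨↦⟩⟫ ((A ⇒□) ∷ K) X s K<w =
  trans (plug-⟪⟨↦⟩⟫ K _ s (m⊔n<o⇒n<o _ _ K<w))
        (cong (λ Y → plug K (Y ⇒ _)) (⟪⟫-fresh A s (m⊔n<o⇒m<o _ _ K<w)))
plug-⟪⟨↦⟩⟫ ((t ∶□) ∷ K) X s K<w =
  trans (plug-⟪⟨↦⟩⟫ K _ s (m⊔n<o⇒n<o _ _ K<w))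
        (cong (λ u → plug K (u ∶ _)) (⟪⟫ᵗ-fresh t s (m⊔n<o⇒m<o _ _ K<w)))

taut-id : ∀ A → Tautology (A ⇒ A)
taut-id A f with evalPL f A
... | true  = refl
... | false = refl

taut-K : ∀ A B → Tautology (A ⇒ B ⇒ A)
taut-K A B f with evalPL f A | evalPL f B
... | true  | true  = refl
... | true  | false = refl
... | false | true  = refl
... | false | false = refl

taut-S : ∀ A B C → Tautology ((A ⇒ B ⇒ C) ⇒ (A ⇒ B) ⇒ A ⇒ C)
taut-S A B C f with evalPL f A | evalPL f B | evalPL f C
... | true  | true  | true  = refl
... | true  | true  | false = refl
... | true  | false | true  = refl
... | true  | false | false = refl
... | false | true  | true  = refl
... | false | true  | false = refl
... | false | false | true  = refl
... | false | false | false = refl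

taut-trans : ∀ A B C → Tautology ((A ⇒ B) ⇒ (B ⇒ C) ⇒ A ⇒ C)
taut-trans A B C f with evalPL f A | evalPL f B | evalPL f C
... | true  | true  | true  = refl
... | true  | true  | false = refl
... | true  | false | true  = refl
... | true  | false | false = refl
... | false | true  | true  = refl
... | false | true  | false = refl
... | false | false | true  = refl
... | false | false | false = refl

taut-dne : ∀ A → Tautology (¬' (¬' A) ⇒ A)
taut-dne A f with evalPL f A
... | true  = refl
... | false = refl

taut-efq : ∀ A B → Tautology (¬' A ⇒ A ⇒ B)
taut-efq A B f with evalPL f A | evalPL f B
... | true  | true  = refl
... | true  | false = refl
... | false | true  = refl
... | false | false = refl

taut-∧-proj₁ : ∀ A B → Tautology (A ∧' B ⇒ A)
taut-∧-proj₁ A B f with evalPL f A | evalPL f B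
... | true  | true  = refl
... | true  | false = refl
... | false | true  = refl
... | false | false = refl

taut-∧-intro : ∀ A B → Tautology (A ⇒ B ⇒ A ∧' B)
taut-∧-intro A B f with evalPL f A | evalPL f B
... | true  | true  = refl
... | true  | false = refl
... | false | true  = refl
... | false | false = refl

taut-∧-weaken : ∀ A B C → Tautology ((A ⇒ C) ⇒ B ∧' A ⇒ C)
taut-∧-weaken A B C f with evalPL f A | evalPL f B | evalPL f C
... | true  | true  | true  = refl
... | true  | true  | false = refl
... | true  | false | true  = refl
... | true  | false | false = refl
... | false | true  | true  = refl
... | false | true  | false = refl
... | false | false | true  = refl
... | false | false | false = refl

taut-cases : ∀ A B → Tautology (¬' (A ∧' B) ⇒ ¬' (¬' A ∧' B) ⇒ ¬' B)
taut-cases A B f with evalPL f A | evalPL f B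
... | true  | true  = refl
... | true  | false = refl
... | false | true  = refl
... | false | false = refl

maxBelow : (ℕ → ℕ) → ℕ → ℕ
maxBelow g zero    = 0
maxBelow g (suc n) = maxBelow g n ⊔ g n

maxBelow-bound : ∀ g {i n} → i < n → g i ≤ maxBelow g n
maxBelow-bound g {i} {suc n} (s≤s i≤n) with m≤n⇒m<n∨m≡n i≤n
... | inj₁ i<n  = m≤n⇒m≤n⊔o (g n) (maxBelow-bound g i<n)
... | inj₂ refl = m≤n⊔m (maxBelow g n) (g n)

module Provability (T : Theory) where

  ⊢-taut : ∀ {A} → Tautology A → T ⊢ A
  ⊢-taut p = ax (CL p)

  mp₂ : ∀ {A B C} → T ⊢ A ⇒ B ⇒ C → T ⊢ A → T ⊢ B → T ⊢ C
  mp₂ d a b = mp (mp d a) b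

  ⊢-refl : ∀ {A} → T ⊢ A ⇒ A
  ⊢-refl {A} = ⊢-taut (taut-id A)

  ⊢-trans : ∀ {A B C} → T ⊢ A ⇒ B → T ⊢ B ⇒ C → T ⊢ A ⇒ C
  ⊢-trans {A} {B} {C} = mp₂ (⊢-taut (taut-trans A B C))

  ⊢-⟪⨾⟨↦⟩⟫ : ∀ {A σ} w s → T ⊢ A ⟪ σ ⟫ → T ⊢ A ⟪ σ ⨾ ⟨ w ↦ s ⟩ ⟫
  ⊢-⟪⨾⟨↦⟩⟫ {A} {σ} w s d =
    subst (T ⊢_) (trans ([≔]-⟨↦⟩ (A ⟪ σ ⟫) w s) (⟪⟫-∘ σ ⟨ w ↦ s ⟩ A)) (jv w s d)

  ⊢-⟪⟫-chain : ∀ {A} (θ : ℕ → Subst) (w : ℕ → JVar) (s : ℕ → Term) K →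
    (∀ k → k < K → θ k ⨾ ⟨ w k ↦ s k ⟩ ≗ θ (suc k) within maxVar A) →
    T ⊢ A ⟪ θ 0 ⟫ → T ⊢ A ⟪ θ K ⟫
  ⊢-⟪⟫-chain θ w s zero    step d = d
  ⊢-⟪⟫-chain {A} θ w s (suc K) step d =
    subst (T ⊢_) (⟪⟫-cong A (step K ≤-refl))
      (⊢-⟪⨾⟨↦⟩⟫ (w K) (s K)
        (⊢-⟪⟫-chain θ w s K (λ k k<K → step k (m<n⇒m<1+n k<K)) d))

  module _ (A : Fml) (σ : Subst) where
    private
      N M : ℕ
      N = suc (maxVar A)
      M = suc (maxVar A ⊔ maxBelow (maxVarᵗ ∘ σ) N)

      N≤M : N ≤ M
      N≤M = s≤s (m≤m⊔n _ _)

      σ-below-M : ∀ {i} → i < N → maxVarᵗ (σ i) < M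
      σ-below-M i<N = s≤s (m≤n⇒m≤o⊔n (maxVar A) (maxBelow-bound (maxVarᵗ ∘ σ) i<N))

      at-bound : ∀ {i k} → ¬ i < k → i < suc k → i ≡ k
      at-bound i≮k i<1+k = ≤-antisym (s≤s⁻¹ i<1+k) (≮⇒≥ i≮k)

      shift : ℕ → Subst
      shift k i with i <? k
      ... | yes _ = var (M + i)
      ... | no  _ = var i

      fill : ℕ → Subst
      fill k i with i <? k
      ... | yes _ = σ i
      ... | no  _ = var (M + i)

      shift-step : ∀ k → k < M → shift k ⨾ ⟨ k ↦ var (M + k) ⟩ ≗ shift (suc k) within maxVar A
      shift-step k k<M i _ with i <? k | i <? suc k
      ... | yes i<k | yes _     =
        [↦]-other var k _ (λ M+i≡k → <-irrefl (sym M+i≡k) (<-≤-trans k<M (m≤m+n M i)))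
      ... | yes i<k | no  i≮1+k = ⊥-elim (i≮1+k (m<n⇒m<1+n i<k))
      ... | no  i≮k | yes i<1+k rewrite at-bound i≮k i<1+k = [↦]-same var k _
      ... | no  i≮k | no  i≮1+k = [↦]-other var k _ (λ { refl → i≮1+k ≤-refl })

      fill-step : ∀ k → k < N → fill k ⨾ ⟨ M + k ↦ σ k ⟩ ≗ fill (suc k) within maxVar A
      fill-step k k<N i i≤A with i <? k | i <? suc k
      ... | yes i<k | yes _     =
        ⟪⟫ᵗ-fresh (σ i) (σ k) (<-≤-trans (σ-below-M (s≤s i≤A)) (m≤m+n M k))
      ... | yes i<k | no  i≮1+k = ⊥-elim (i≮1+k (m<n⇒m<1+n i<k))
      ... | no  i≮k | yes i<1+k rewrite at-bound i≮k i<1+k = [↦]-same var (M + k) _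
      ... | no  i≮k | no  i≮1+k =
        [↦]-other var (M + k) _ (λ M+i≡M+k → i≮1+k (s≤s (≤-reflexive (+-cancelˡ-≡ M i k M+i≡M+k))))

      shift-start : shift 0 ≗ var within maxVar A
      shift-start i _ with i <? 0
      ... | no _ = refl

      shift-end≗fill-start : shift N ≗ fill 0 within maxVar A
      shift-end≗fill-start i i≤A with i <? N | i <? 0
      ... | yes _ | no _ = refl
      ... | no i≮N | _   = ⊥-elim (i≮N (s≤s i≤A))

      fill-end : fill N ≗ σ within maxVar A
      fill-end i i≤A with i <? N
      ... | yes _  = refl
      ... | no i≮N = ⊥-elim (i≮N (s≤s i≤A))

    -- (jv) substitutes one variable at a time; first moving the variables of A to a fresh block
    -- (shift) and then filling that block (fill) makes the sequence act simultaneously.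
    ⊢-⟪⟫ : T ⊢ A → T ⊢ A ⟪ σ ⟫
    ⊢-⟪⟫ ⊢A = subst (T ⊢_) (⟪⟫-cong A fill-end) filled
      where
      shifted : T ⊢ A ⟪ shift N ⟫
      shifted = ⊢-⟪⟫-chain shift (λ k → k) (λ k → var (M + k)) N
                  (λ k k<N → shift-step k (<-≤-trans k<N N≤M))
                  (subst (T ⊢_) (sym (⟪⟫-trivial A shift-start)) ⊢A)

      filled : T ⊢ A ⟪ fill N ⟫
      filled = ⊢-⟪⟫-chain fill (M +_) σ N fill-step
                 (subst (T ⊢_) (⟪⟫-cong A shift-end≗fill-start) shifted)

  ⊢-⇔⇒ : ∀ {A B} → T ⊢ A ⇔' B → T ⊢ A ⇒ B
  ⊢-⇔⇒ {A} {B} = mp (⊢-taut (taut-∧-proj₁ (A ⇒ B) (B ⇒ A)))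

  ⊢-j : ∀ s t A B → T ⊢ s ∶ (A ⇒ B) ⇒ t ∶ A ⇒ s · t ∶ B
  ⊢-j s t A B = subst (T ⊢_) instance-eq (⊢-⟪⟫ _ τ (ax (ax-j n (suc n) A B)))
    where
    n = suc (maxVar A ⊔ maxVar B)
    τ = ⟨ n ↦ s ∣ t ∣ t ⟩
    instance-eq : (var n ∶ (A ⇒ B) ⇒ var (suc n) ∶ A ⇒ var n · var (suc n) ∶ B) ⟪ τ ⟫
                ≡ (s ∶ (A ⇒ B) ⇒ t ∶ A ⇒ s · t ∶ B)
    instance-eq
      rewrite ⟪⟫-trivial A (⟨↦∣∣⟩-fresh s t t (s≤s (m≤m⊔n (maxVar A) (maxVar B))))
            | ⟪⟫-trivial B (⟨↦∣∣⟩-fresh s t t (s≤s (m≤n⊔m (maxVar A) (maxVar B))))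
            | ⟨↦∣∣⟩-₀ n s t t | ⟨↦∣∣⟩-₁ n s t t = refl

  ⊢-j+ : ∀ s t A → T ⊢ s ∶ A ∧' t ∶ A ⇒ (s ⊕ t) ∶ A
  ⊢-j+ s t A = subst (T ⊢_) instance-eq (⊢-⟪⟫ _ τ (ax (ax-j+ n (suc n) A)))
    where
    n = suc (maxVar A)
    τ = ⟨ n ↦ s ∣ t ∣ t ⟩
    instance-eq : (var n ∶ A ∧' var (suc n) ∶ A ⇒ (var n ⊕ var (suc n)) ∶ A) ⟪ τ ⟫
                ≡ (s ∶ A ∧' t ∶ A ⇒ (s ⊕ t) ∶ A)
    instance-eq
      rewrite ⟪⟫-trivial A (⟨↦∣∣⟩-fresh s t t ≤-refl)
            | ⟨↦∣∣⟩-₀ n s t t | ⟨↦∣∣⟩-₁ n s t t = refl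

  infix 4 _~_

  _~_ : Term → Term → Set
  s ~ t = ∀ A w → T ⊢ A ⟪ ⟨ w ↦ s ⟩ ⟫ ⇒ A ⟪ ⟨ w ↦ t ⟩ ⟫

  ~-refl : ∀ {s} → s ~ s
  ~-refl A w = ⊢-refl

  ~-trans : ∀ {s t u} → s ~ t → t ~ u → s ~ u
  ~-trans s~t t~u A w = ⊢-trans (s~t A w) (t~u A w)

  -- s ~ t at the formula A[w ↦ h] ⇒ A[w ↦ s], h fresh, turns the trivial implication
  -- A[w ↦ s] ⇒ A[w ↦ s] into A[w ↦ t] ⇒ A[w ↦ s].
  ~-sym : ∀ {s t} → s ~ t → t ~ s
  ~-sym {s} {t} s~t A w = mp (subst (T ⊢_) (cong₂ _⇒_ (B[h↦ s ]) (B[h↦ t ])) (s~t B h)) ⊢-refl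
    where
    h = suc (maxVar A ⊔ maxVarᵗ s)
    A<h : maxVar A < h
    A<h = s≤s (m≤m⊔n _ _)
    B = A ⟪ ⟨ w ↦ var h ⟩ ⟫ ⇒ A ⟪ ⟨ w ↦ s ⟩ ⟫
    B[h↦_] : ∀ r → B ⟪ ⟨ h ↦ r ⟩ ⟫ ≡ (A ⟪ ⟨ w ↦ r ⟩ ⟫ ⇒ A ⟪ ⟨ w ↦ s ⟩ ⟫)
    B[h↦ r ] = cong₂ _⇒_ (⟪⟨↦⟩⟫-hole A w (λ x → x) r A<h ([↦]-same var h r))
                         (⟪⟨↦⟩⟫-hole A w (λ _ → s) r A<h (⟪⟫ᵗ-fresh s r (s≤s (m≤n⊔m _ _))))

  ~-cong : ∀ (P : Term → Term) b → (∀ {h} r → b < h → P (var h) ⟪ ⟨ h ↦ r ⟩ ⟫ᵗ ≡ P r) →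
           ∀ {s t} → s ~ t → P s ~ P t
  ~-cong P b P-hole {s} {t} s~t A w =
    subst (T ⊢_) (cong₂ _⇒_ (⟪⟨↦⟩⟫-hole A w P s A<h (P-hole s b<h))
                            (⟪⟨↦⟩⟫-hole A w P t A<h (P-hole t b<h)))
      (s~t (A ⟪ ⟨ w ↦ P (var h) ⟩ ⟫) h)
    where
    h = suc (maxVar A ⊔ b)
    A<h : maxVar A < h
    A<h = s≤s (m≤m⊔n _ _)
    b<h : b < h
    b<h = s≤s (m≤n⊔m _ _)

  ~-cong₂ : ∀ (_∙_ : Term → Term → Term) → (∀ σ a b → (a ∙ b) ⟪ σ ⟫ᵗ ≡ (a ⟪ σ ⟫ᵗ) ∙ (b ⟪ σ ⟫ᵗ)) →
            ∀ {s s′ t t′} → s ~ s′ → t ~ t′ → s ∙ t ~ s′ ∙ t′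
  ~-cong₂ _∙_ natural {s′ = s′} {t} s~s′ t~t′ =
    ~-trans (~-cong (_∙ t) (maxVarᵗ t) hole-left s~s′) (~-cong (s′ ∙_) (maxVarᵗ s′) hole-right t~t′)
    where
    hole-left : ∀ {h} r → maxVarᵗ t < h → (var h ∙ t) ⟪ ⟨ h ↦ r ⟩ ⟫ᵗ ≡ r ∙ t
    hole-left {h} r t<h =
      trans (natural _ (var h) t) (cong₂ _∙_ ([↦]-same var h r) (⟪⟫ᵗ-fresh t r t<h))

    hole-right : ∀ {h} r → maxVarᵗ s′ < h → (s′ ∙ var h) ⟪ ⟨ h ↦ r ⟩ ⟫ᵗ ≡ s′ ∙ r
    hole-right {h} r s′<h =
      trans (natural _ s′ (var h)) (cong₂ _∙_ (⟪⟫ᵗ-fresh s′ r s′<h) ([↦]-same var h r))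

  ~-⊕ : ∀ {s s′ t t′} → s ~ s′ → t ~ t′ → s ⊕ t ~ s′ ⊕ t′
  ~-⊕ = ~-cong₂ _⊕_ (λ _ _ _ → refl)

  ~-· : ∀ {s s′ t t′} → s ~ s′ → t ~ t′ → s · t ~ s′ · t′
  ~-· = ~-cong₂ _·_ (λ _ _ _ → refl)

  ~-isEquivalence : IsEquivalence _~_
  ~-isEquivalence = record { refl = ~-refl ; sym = ~-sym ; trans = ~-trans }

  ⟪⟫ᵗ-~ : ∀ {σ} → (∀ i → σ i ~ var i) → ∀ t → t ⟪ σ ⟫ᵗ ~ t
  ⟪⟫ᵗ-~ σ~var (con k) = ~-refl
  ⟪⟫ᵗ-~ σ~var (var x) = σ~var x
  ⟪⟫ᵗ-~ σ~var (s · t) = ~-· (⟪⟫ᵗ-~ σ~var s) (⟪⟫ᵗ-~ σ~var t)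
  ⟪⟫ᵗ-~ σ~var (s ⊕ t) = ~-⊕ (⟪⟫ᵗ-~ σ~var s) (⟪⟫ᵗ-~ σ~var t)

  ~-scheme : ∀ (P Q : Pattern) → Natural P → Natural Q →
    (∀ A w x y z → T ⊢ A [ w ≔ P (var x) (var y) (var z) ] ⇒ A [ w ≔ Q (var x) (var y) (var z) ]) →
    ∀ s u r → P s u r ~ Q s u r
  ~-scheme P Q natural-P natural-Q scheme s u r A w =
    subst (T ⊢_) (cong₂ _⇒_ (instance-eq P natural-P) (instance-eq Q natural-Q))
      (⊢-⟪⟫ _ τ scheme-at-n)
    where
    n = suc (maxVar A)
    τ = ⟨ n ↦ s ∣ u ∣ r ⟩

    at-n : Pattern → Term
    at-n R = R (var n) (var (suc n)) (var (suc (suc n)))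

    scheme-at-n : T ⊢ A ⟪ ⟨ w ↦ at-n P ⟩ ⟫ ⇒ A ⟪ ⟨ w ↦ at-n Q ⟩ ⟫
    scheme-at-n =
      subst (T ⊢_) (cong₂ _⇒_ ([≔]-⟨↦⟩ A w _) ([≔]-⟨↦⟩ A w _)) (scheme A w n (suc n) (suc (suc n)))

    at-n-⟪τ⟫ : ∀ R → Natural R → at-n R ⟪ τ ⟫ᵗ ≡ R s u r
    at-n-⟪τ⟫ R natural-R =
      trans (natural-R τ _ _ _)
        (trans (cong₂ (λ a b → R a b (τ (suc (suc n)))) (⟨↦∣∣⟩-₀ n s u r) (⟨↦∣∣⟩-₁ n s u r))
               (cong (R s u) (⟨↦∣∣⟩-₂ n s u r)))

    instance-eq : ∀ R → Natural R → A ⟪ ⟨ w ↦ at-n R ⟩ ⟫ ⟪ τ ⟫ ≡ A ⟪ ⟨ w ↦ R s u r ⟩ ⟫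
    instance-eq R natural-R =
      trans (⟪⟨↦⟩⟫-⨾ A w _ (⟨↦∣∣⟩-fresh s u r ≤-refl))
            (cong (λ t → A ⟪ ⟨ w ↦ t ⟩ ⟫) (at-n-⟪τ⟫ R natural-R))

  ~-+-assoc : ∀ s u r → (s ⊕ u) ⊕ r ~ s ⊕ (u ⊕ r)
  ~-+-assoc = ~-scheme (λ a b c → (a ⊕ b) ⊕ c) (λ a b c → a ⊕ (b ⊕ c))
    (λ _ _ _ _ → refl) (λ _ _ _ _ → refl) (λ A w x y z → ax (ax-a+ A w x y z))

  ~-+-comm : ∀ s u → s ⊕ u ~ u ⊕ s
  ~-+-comm s u = ~-scheme (λ a b _ → a ⊕ b) (λ a b _ → b ⊕ a)
    (λ _ _ _ _ → refl) (λ _ _ _ _ → refl) (λ A w x y _ → ax (ax-c+ A w x y)) s u s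

  ~-+-identityʳ : ∀ s → s ⊕ 𝟘 ~ s
  ~-+-identityʳ s = ~-scheme (λ a _ _ → a ⊕ 𝟘) (λ a _ _ → a)
    (λ _ _ _ _ → refl) (λ _ _ _ _ → refl) (λ A w x _ _ → ⊢-⇔⇒ (ax (ax-0+ A w x))) s s s

  ~-*-assoc : ∀ s u r → (s · u) · r ~ s · (u · r)
  ~-*-assoc = ~-scheme (λ a b c → (a · b) · c) (λ a b c → a · (b · c))
    (λ _ _ _ _ → refl) (λ _ _ _ _ → refl) (λ A w x y z → ⊢-⇔⇒ (ax (ax-am A w x y z)))

  ~-zeroʳ : ∀ s → s · 𝟘 ~ 𝟘
  ~-zeroʳ s = ~-scheme (λ a _ _ → a · 𝟘) (λ _ _ _ → 𝟘)
    (λ _ _ _ _ → refl) (λ _ _ _ _ → refl) (λ A w x _ _ → ⊢-⇔⇒ (ax (ax-a0r A w x))) s s s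

  ~-zeroˡ : ∀ s → 𝟘 · s ~ 𝟘
  ~-zeroˡ s = ~-scheme (λ a _ _ → 𝟘 · a) (λ _ _ _ → 𝟘)
    (λ _ _ _ _ → refl) (λ _ _ _ _ → refl) (λ A w x _ _ → ⊢-⇔⇒ (ax (ax-a0l A w x))) s s s

  ~-*-identityʳ : ∀ s → s · 𝟙 ~ s
  ~-*-identityʳ s = ~-scheme (λ a _ _ → a · 𝟙) (λ a _ _ → a)
    (λ _ _ _ _ → refl) (λ _ _ _ _ → refl) (λ A w x _ _ → ⊢-⇔⇒ (ax (ax-a1r A w x))) s s s

  ~-*-identityˡ : ∀ s → 𝟙 · s ~ s
  ~-*-identityˡ s = ~-scheme (λ a _ _ → 𝟙 · a) (λ a _ _ → a)
    (λ _ _ _ _ → refl) (λ _ _ _ _ → refl) (λ A w x _ _ → ⊢-⇔⇒ (ax (ax-a1l A w x))) s s s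

  ~-distribˡ : ∀ s u r → s · (u ⊕ r) ~ s · u ⊕ s · r
  ~-distribˡ = ~-scheme (λ a b c → a · (b ⊕ c)) (λ a b c → a · b ⊕ a · c)
    (λ _ _ _ _ → refl) (λ _ _ _ _ → refl) (λ A w x y z → ⊢-⇔⇒ (ax (ax-dl A w x y z)))

  ~-distribʳ : ∀ s u r → (u ⊕ r) · s ~ u · s ⊕ r · s
  ~-distribʳ = ~-scheme (λ a b c → (b ⊕ c) · a) (λ a b c → b · a ⊕ c · a)
    (λ _ _ _ _ → refl) (λ _ _ _ _ → refl) (λ A w x y z → ⊢-⇔⇒ (ax (ax-dr A w x y z)))

  -- Without necessitation, T ⊢ A ⇒ B does not give T ⊢ t ∶ A ⇒ t ∶ B, so rewriting below ∶
  -- has to be done in all contexts at once.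
  infix 4 _⊑_

  _⊑_ : Fml → Fml → Set
  A ⊑ B = ∀ K → T ⊢ plug K A ⇒ plug K B

  ⊑-trans : ∀ {A B C} → A ⊑ B → B ⊑ C → A ⊑ C
  ⊑-trans A⊑B B⊑C K = ⊢-trans (A⊑B K) (B⊑C K)

  ⊑-∶ : ∀ {s t} A → s ~ t → s ∶ A ⊑ t ∶ A
  ⊑-∶ {s} {t} A s~t K =
    subst (T ⊢_) (cong₂ _⇒_ (plug-at s) (plug-at t)) (s~t (plug K (var h ∶ A)) h)
    where
    h = suc (maxVarᶜ K ⊔ maxVar A)
    plug-at : ∀ r → plug K (var h ∶ A) ⟪ ⟨ h ↦ r ⟩ ⟫ ≡ plug K (r ∶ A)
    plug-at r = trans (plug-⟪⟨↦⟩⟫ K (var h ∶ A) r (s≤s (m≤m⊔n _ _)))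
      (cong (plug K) (cong₂ _∶_ ([↦]-same var h r) (⟪⟫-fresh A r (s≤s (m≤n⊔m _ _)))))

  ⊑-mapF : ∀ {f g : Term → Term} → (∀ t → f t ~ g t) → ∀ A → mapF f A ⊑ mapF g A
  ⊑-mapF f~g ⊥'       K = ⊢-refl
  ⊑-mapF f~g (atom p) K = ⊢-refl
  ⊑-mapF {f} {g} f~g (A ⇒ B) =
    ⊑-trans (λ K → ⊑-mapF f~g A (□⇒ mapF f B ∷ K)) (λ K → ⊑-mapF f~g B (mapF g A ⇒□ ∷ K))
  ⊑-mapF {f} {g} f~g (s ∶ A) =
    ⊑-trans (⊑-∶ (mapF f A) (f~g s)) (λ K → ⊑-mapF f~g A (g s ∶□ ∷ K))

-- Prefix codes: every constructor is tagged by a few bits and the continuation k holds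
-- whatever follows, so injectivity is proved by peeling off bits.
encodeℕ : ℕ → ℕᵇ → ℕᵇ
encodeℕ zero    k = 2[1+ k ]
encodeℕ (suc n) k = 1+[2 encodeℕ n k ]

encodeJConst : JConst → ℕᵇ → ℕᵇ
encodeJConst c0    k = 2[1+ k ]
encodeJConst c1    k = 1+[2 2[1+ k ] ]
encodeJConst (c n) k = 1+[2 1+[2 encodeℕ n k ] ]

encodeTerm : Term → ℕᵇ → ℕᵇ
encodeTerm (con j) k = 2[1+ 2[1+ encodeJConst j k ] ]
encodeTerm (var x) k = 2[1+ 1+[2 encodeℕ x k ] ]
encodeTerm (s · t) k = 1+[2 2[1+ encodeTerm s (encodeTerm t k) ] ]
encodeTerm (s ⊕ t) k = 1+[2 1+[2 encodeTerm s (encodeTerm t k) ] ]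

encodeFml : Fml → ℕᵇ → ℕᵇ
encodeFml ⊥'       k = 2[1+ 2[1+ k ] ]
encodeFml (atom p) k = 2[1+ 1+[2 encodeℕ p k ] ]
encodeFml (A ⇒ B)  k = 1+[2 2[1+ encodeFml A (encodeFml B k) ] ]
encodeFml (t ∶ A)  k = 1+[2 1+[2 encodeTerm t (encodeFml A k) ] ]

2[1+]-injective : ∀ {x y} → 2[1+ x ] ≡ 2[1+ y ] → x ≡ y
2[1+]-injective refl = refl

1+[2]-injective : ∀ {x y} → 1+[2 x ] ≡ 1+[2 y ] → x ≡ y
1+[2]-injective refl = refl

Prefix-injective : {X : Set} → (X → ℕᵇ → ℕᵇ) → Set
Prefix-injective {X} encode = ∀ x y {k l} → encode x k ≡ encode y l → x ≡ y × k ≡ l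

encodeℕ-injective : Prefix-injective encodeℕ
encodeℕ-injective zero    zero    e = refl , 2[1+]-injective e
encodeℕ-injective (suc m) (suc n) e with encodeℕ-injective m n (1+[2]-injective e)
... | refl , k≡l = refl , k≡l
encodeℕ-injective zero    (suc n) ()
encodeℕ-injective (suc m) zero    ()

encodeJConst-injective : Prefix-injective encodeJConst
encodeJConst-injective c0    c0    e = refl , 2[1+]-injective e
encodeJConst-injective c1    c1    e = refl , 2[1+]-injective (1+[2]-injective e)
encodeJConst-injective (c m) (c n) e
  with encodeℕ-injective m n (1+[2]-injective (1+[2]-injective e))
... | refl , k≡l = refl , k≡l
encodeJConst-injective c0    c1    ()
encodeJConst-injective c0    (c _) ()
encodeJConst-injective c1    c0    ()
encodeJConst-injective c1    (c _) ()
encodeJConst-injective (c _) c0    ()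
encodeJConst-injective (c _) c1    ()

encodeTerm-injective : Prefix-injective encodeTerm
encodeTerm-injective (con i) (con j) e
  with encodeJConst-injective i j (2[1+]-injective (2[1+]-injective e))
... | refl , k≡l = refl , k≡l
encodeTerm-injective (var x) (var y) e
  with encodeℕ-injective x y (1+[2]-injective (2[1+]-injective e))
... | refl , k≡l = refl , k≡l
encodeTerm-injective (s · t) (s′ · t′) e
  with encodeTerm-injective s s′ (2[1+]-injective (1+[2]-injective e))
... | refl , rest with encodeTerm-injective t t′ rest
...   | refl , k≡l = refl , k≡l
encodeTerm-injective (s ⊕ t) (s′ ⊕ t′) e
  with encodeTerm-injective s s′ (1+[2]-injective (1+[2]-injective e))
... | refl , rest with encodeTerm-injective t t′ rest
...   | refl , k≡l = refl , k≡l
encodeTerm-injective (con _) (var _) ()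
encodeTerm-injective (con _) (_ · _) ()
encodeTerm-injective (con _) (_ ⊕ _) ()
encodeTerm-injective (var _) (con _) ()
encodeTerm-injective (var _) (_ · _) ()
encodeTerm-injective (var _) (_ ⊕ _) ()
encodeTerm-injective (_ · _) (con _) ()
encodeTerm-injective (_ · _) (var _) ()
encodeTerm-injective (_ · _) (_ ⊕ _) ()
encodeTerm-injective (_ ⊕ _) (con _) ()
encodeTerm-injective (_ ⊕ _) (var _) ()
encodeTerm-injective (_ ⊕ _) (_ · _) ()

encodeFml-injective : Prefix-injective encodeFml
encodeFml-injective ⊥'       ⊥'        e = refl , 2[1+]-injective (2[1+]-injective e)
encodeFml-injective (atom p) (atom q)  e
  with encodeℕ-injective p q (1+[2]-injective (2[1+]-injective e))
... | refl , k≡l = refl , k≡l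
encodeFml-injective (A ⇒ B)  (A′ ⇒ B′) e
  with encodeFml-injective A A′ (2[1+]-injective (1+[2]-injective e))
... | refl , rest with encodeFml-injective B B′ rest
...   | refl , k≡l = refl , k≡l
encodeFml-injective (t ∶ A)  (t′ ∶ A′) e
  with encodeTerm-injective t t′ (1+[2]-injective (1+[2]-injective e))
... | refl , rest with encodeFml-injective A A′ rest
...   | refl , k≡l = refl , k≡l
encodeFml-injective ⊥'       (atom _) ()
encodeFml-injective ⊥'       (_ ⇒ _)  ()
encodeFml-injective ⊥'       (_ ∶ _)  ()
encodeFml-injective (atom _) ⊥'       ()
encodeFml-injective (atom _) (_ ⇒ _)  ()
encodeFml-injective (atom _) (_ ∶ _)  ()
encodeFml-injective (_ ⇒ _)  ⊥'       ()
encodeFml-injective (_ ⇒ _)  (atom _) ()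
encodeFml-injective (_ ⇒ _)  (_ ∶ _)  ()
encodeFml-injective (_ ∶ _)  ⊥'       ()
encodeFml-injective (_ ∶ _)  (atom _) ()
encodeFml-injective (_ ∶ _)  (_ ⇒ _)  ()

codeTerm : Term → ℕ
codeTerm t = toℕ (encodeTerm t zeroᵇ)

codeTerm-injective : ∀ {s t} → codeTerm s ≡ codeTerm t → s ≡ t
codeTerm-injective {s} {t} e = proj₁ (encodeTerm-injective s t (toℕ-injective e))

codeFml : Fml → ℕ
codeFml A = toℕ (encodeFml A zeroᵇ)

codeFml-injective : ∀ {A B} → codeFml A ≡ codeFml B → A ≡ B
codeFml-injective {A} {B} e = proj₁ (encodeFml-injective A B (toℕ-injective e))

module _ (em : ExcludedMiddle 0ℓ) where

  least : ∀ (P : ℕ → Set) {n} → P n → Σ[ m ∈ ℕ ] P m × (∀ k → k < m → ¬ P k)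
  least P {n} = search (suc n) ≤-refl
    where
    search : ∀ bound {n} → n < bound → P n → Σ[ m ∈ ℕ ] P m × (∀ k → k < m → ¬ P k)
    search (suc bound) {n} (s≤s n≤bound) Pn with em {Σ[ k ∈ ℕ ] k < n × P k}
    ... | yes (k , k<n , Pk) = search bound (<-≤-trans k<n n≤bound) Pk
    ... | no  none-below     = n , Pn , λ k k<n Pk → none-below (k , k<n , Pk)

  module Enumeration {X : Set} (code : X → ℕ) (code-injective : ∀ {x y} → code x ≡ code y → x ≡ y)
                     (default : X) where

    enumerate : ℕ → X
    enumerate n with em {Σ[ x ∈ X ] code x ≡ n}
    ... | yes (x , _) = x
    ... | no  _       = default

    enumerate-code : ∀ x → enumerate (code x) ≡ x
    enumerate-code x with em {Σ[ y ∈ X ] code y ≡ code x}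
    ... | yes (y , code-y≡code-x) = code-injective code-y≡code-x
    ... | no  none                = ⊥-elim (none (x , refl))

  -- Each ≈-class is represented by its element of least code.
  module Quotient {X : Set} (code : X → ℕ) (code-injective : ∀ {x y} → code x ≡ code y → x ≡ y)
                  {_≈_ : X → X → Set} (≈-isEquivalence : IsEquivalence _≈_) where
    open IsEquivalence ≈-isEquivalence renaming (refl to ≈-refl; sym to ≈-sym; trans to ≈-trans)

    private
      CodeOfClass : X → ℕ → Set
      CodeOfClass x n = Σ[ y ∈ X ] code y ≡ n × y ≈ x

      leastCode : ∀ x → Σ[ m ∈ ℕ ] CodeOfClass x m × (∀ k → k < m → ¬ CodeOfClass x k)
      leastCode x = least (CodeOfClass x) (x , refl , ≈-refl)

    -- abstract keeps unification from unfolding the classical search.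
    abstract
      canon : X → X
      canon x = proj₁ (proj₁ (proj₂ (leastCode x)))

      canon-≈ : ∀ x → canon x ≈ x
      canon-≈ x = proj₂ (proj₂ (proj₁ (proj₂ (leastCode x))))

      canon-resp-≈ : ∀ {x y} → x ≈ y → canon x ≡ canon y
      canon-resp-≈ {x} {y} x≈y with leastCode x | leastCode y
      ... | m , (u , code-u , u≈x) , x-least | n , (v , code-v , v≈y) , y-least with <-cmp m n
      ... | tri< m<n _ _ = ⊥-elim (y-least m m<n (u , code-u , ≈-trans u≈x x≈y))
      ... | tri> _ _ n<m = ⊥-elim (x-least n n<m (v , code-v , ≈-trans v≈y (≈-sym x≈y)))
      ... | tri≈ _ refl _ = code-injective (trans code-u (sym code-v))

    Carrier : Set
    Carrier = Σ[ x ∈ X ] canon x ≡ x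

    rep : Carrier → X
    rep = proj₁

    [_] : X → Carrier
    [ x ] = canon x , canon-resp-≈ (canon-≈ x)

    private
      _≟ˣ_ : DecidableEquality X
      x ≟ˣ y with code x ≟ code y
      ... | yes e = yes (code-injective e)
      ... | no ne = no (ne ∘ cong code)

      rep-injective : ∀ {a b} → rep a ≡ rep b → a ≡ b
      rep-injective {x , p} {.x , q} refl = cong (x ,_) (Decidable⇒UIP.≡-irrelevant _≟ˣ_ p q)

    [_]-resp-≈ : ∀ {x y} → x ≈ y → [ x ] ≡ [ y ]
    [_]-resp-≈ x≈y = rep-injective (canon-resp-≈ x≈y)

    [rep] : ∀ a → [ rep a ] ≡ a
    [rep] a = rep-injective (proj₂ a)

    rep[_] : ∀ x → rep [ x ] ≈ x
    rep[_] = canon-≈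

record MaximalConsistent (T : Theory) : Set₁ where
  field
    Γ            : Fml → Set
    theorem      : ∀ {A} → T ⊢ A → Γ A
    modus-ponens : ∀ {A B} → Γ (A ⇒ B) → Γ A → Γ B
    consistent   : ¬ Γ ⊥'
    complete     : ∀ A → Γ A ⊎ Γ (¬' A)

  open Provability T

  Γ-⊢ : ∀ {A B} → T ⊢ A ⇒ B → Γ A → Γ B
  Γ-⊢ A⇒B = modus-ponens (theorem A⇒B)

  Γ-⊑ : ∀ {A B} → A ⊑ B → Γ A → Γ B
  Γ-⊑ A⊑B = Γ-⊢ (A⊑B [])

  Γ-⇒-intro : ∀ {A B} → (Γ A → Γ B) → Γ (A ⇒ B)
  Γ-⇒-intro {A} {B} f with complete A
  ... | inj₁ ΓA  = Γ-⊢ (⊢-taut (taut-K B A)) (f ΓA)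
  ... | inj₂ Γ¬A = Γ-⊢ (⊢-taut (taut-efq A B)) Γ¬A

  Γ-mapF : ∀ {f} → (∀ t → f t ~ t) → ∀ A → Γ (mapF f A) ⇔ Γ A
  Γ-mapF f~id A = mk⇔ (Γ-⊑ (subst (mapF _ A ⊑_) (mapF-id A) (⊑-mapF f~id A)))
                      (Γ-⊑ (subst (_⊑ mapF _ A) (mapF-id A) (⊑-mapF (~-sym ∘ f~id) A)))

  Γ-∧-intro : ∀ {A B} → Γ A → Γ B → Γ (A ∧' B)
  Γ-∧-intro {A} {B} ΓA ΓB = modus-ponens (Γ-⊢ (⊢-taut (taut-∧-intro A B)) ΓA) ΓB

module Lindenbaum (em : ExcludedMiddle 0ℓ) {T : Theory} (C : Fml) (C-consistent : ¬ (T ⊢ ¬' C))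
  where
  open Provability T
  open Enumeration em codeFml codeFml-injective ⊥'

  Consistent : Fml → Set
  Consistent X = ¬ (T ⊢ ¬' X)

  decide : (A X : Fml) → Dec (Consistent (A ∧' X)) → Fml
  decide A X (yes _) = A
  decide A X (no  _) = ¬' A

  chain : ℕ → Fml
  chosen : ℕ → Fml

  chain zero    = C
  chain (suc n) = chosen n ∧' chain n

  chosen n = decide (enumerate n) (chain n) em

  decide-consistent : ∀ A X d → Consistent X → Consistent (decide A X d ∧' X)
  decide-consistent A X (yes A∧X-consistent) _ = A∧X-consistent
  decide-consistent A X (no  A∧X-inconsistent) X-consistent ⊢¬[¬A∧X] =
    A∧X-inconsistent λ ⊢¬[A∧X] → X-consistent (mp₂ (⊢-taut (taut-cases A X)) ⊢¬[A∧X] ⊢¬[¬A∧X])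

  decide-decides : ∀ A X d → (T ⊢ decide A X d ∧' X ⇒ A) ⊎ (T ⊢ decide A X d ∧' X ⇒ ¬' A)
  decide-decides A X (yes _) = inj₁ (⊢-taut (taut-∧-proj₁ A X))
  decide-decides A X (no  _) = inj₂ (⊢-taut (taut-∧-proj₁ (¬' A) X))

  chain-consistent : ∀ n → Consistent (chain n)
  chain-consistent zero    = C-consistent
  chain-consistent (suc n) = decide-consistent (enumerate n) (chain n) em (chain-consistent n)

  chain-weaken : ∀ {A m n} → m ≤ n → T ⊢ chain m ⇒ A → T ⊢ chain n ⇒ A
  chain-weaken {n = zero} z≤n ⊢A = ⊢A
  chain-weaken {A} {m} {suc n} m≤1+n ⊢A with m≤n⇒m<n∨m≡n m≤1+n
  ... | inj₂ refl  = ⊢A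
  ... | inj₁ m<1+n =
    mp (⊢-taut (taut-∧-weaken (chain n) (chosen n) A)) (chain-weaken (s≤s⁻¹ m<1+n) ⊢A)

  Γ : Fml → Set
  Γ A = Σ[ n ∈ ℕ ] (T ⊢ chain n ⇒ A)

  Γ-theorem : ∀ {A} → T ⊢ A → Γ A
  Γ-theorem {A} ⊢A = 0 , mp (⊢-taut (taut-K A C)) ⊢A

  Γ-mp : ∀ {A B} → Γ (A ⇒ B) → Γ A → Γ B
  Γ-mp {A} {B} (m , ⊢A⇒B) (n , ⊢A) =
    m ⊔ n , mp₂ (⊢-taut (taut-S (chain (m ⊔ n)) A B))
                (chain-weaken (m≤m⊔n m n) ⊢A⇒B) (chain-weaken (m≤n⊔m m n) ⊢A)

  Γ-consistent : ¬ Γ ⊥'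
  Γ-consistent (n , ⊢¬chain) = chain-consistent n ⊢¬chain

  Γ-decides-enumerate : ∀ n → Γ (enumerate n) ⊎ Γ (¬' (enumerate n))
  Γ-decides-enumerate n with decide-decides (enumerate n) (chain n) em
  ... | inj₁ ⊢A  = inj₁ (suc n , ⊢A)
  ... | inj₂ ⊢¬A = inj₂ (suc n , ⊢¬A)

  Γ-complete : ∀ A → Γ A ⊎ Γ (¬' A)
  Γ-complete A = subst (λ B → Γ B ⊎ Γ (¬' B)) (enumerate-code A) (Γ-decides-enumerate (codeFml A))

  maximalConsistent : MaximalConsistent T
  maximalConsistent = record
    { Γ = Γ ; theorem = Γ-theorem ; modus-ponens = Γ-mp
    ; consistent = Γ-consistent ; complete = Γ-complete
    }

  C-in-Γ : Γ C
  C-in-Γ = 0 , ⊢-refl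

module CanonicalModel (em : ExcludedMiddle 0ℓ) {T : Theory} (𝓜 : MaximalConsistent T) where
  open Provability T
  open MaximalConsistent 𝓜
  open Quotient em codeTerm codeTerm-injective ~-isEquivalence
  open Equivalence

  infixl 6 _+Q_
  infixl 7 _*Q_
  infixr 5 _⟨~⟩_

  _+Q_ _*Q_ : Carrier → Carrier → Carrier
  x +Q y = [ rep x ⊕ rep y ]
  x *Q y = [ rep x · rep y ]

  0Q 1Q : Carrier
  0Q = [ 𝟘 ]
  1Q = [ 𝟙 ]

  private
    _⟨~⟩_ : ∀ {s t u} → s ~ t → t ~ u → s ~ u
    _⟨~⟩_ = ~-trans

  []-+Q : ∀ s t → [ s ] +Q [ t ] ≡ [ s ⊕ t ]
  []-+Q s t = [_]-resp-≈ (~-⊕ rep[ s ] rep[ t ])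

  []-*Q : ∀ s t → [ s ] *Q [ t ] ≡ [ s · t ]
  []-*Q s t = [_]-resp-≈ (~-· rep[ s ] rep[ t ])

  +Q-assoc : ∀ x y z → (x +Q y) +Q z ≡ x +Q (y +Q z)
  +Q-assoc x y z = [_]-resp-≈
    (~-⊕ rep[ _ ] ~-refl ⟨~⟩ ~-+-assoc (rep x) (rep y) (rep z) ⟨~⟩ ~-⊕ ~-refl (~-sym rep[ _ ]))

  +Q-comm : ∀ x y → x +Q y ≡ y +Q x
  +Q-comm x y = [_]-resp-≈ (~-+-comm (rep x) (rep y))

  +Q-identityˡ : ∀ x → 0Q +Q x ≡ x
  +Q-identityˡ x =
    trans ([_]-resp-≈ (~-⊕ rep[ _ ] ~-refl ⟨~⟩ ~-+-comm 𝟘 (rep x) ⟨~⟩ ~-+-identityʳ (rep x)))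
          ([rep] x)

  +Q-identityʳ : ∀ x → x +Q 0Q ≡ x
  +Q-identityʳ x = trans ([_]-resp-≈ (~-⊕ ~-refl rep[ _ ] ⟨~⟩ ~-+-identityʳ (rep x))) ([rep] x)

  *Q-assoc : ∀ x y z → (x *Q y) *Q z ≡ x *Q (y *Q z)
  *Q-assoc x y z = [_]-resp-≈
    (~-· rep[ _ ] ~-refl ⟨~⟩ ~-*-assoc (rep x) (rep y) (rep z) ⟨~⟩ ~-· ~-refl (~-sym rep[ _ ]))

  *Q-identityˡ : ∀ x → 1Q *Q x ≡ x
  *Q-identityˡ x = trans ([_]-resp-≈ (~-· rep[ _ ] ~-refl ⟨~⟩ ~-*-identityˡ (rep x))) ([rep] x)

  *Q-identityʳ : ∀ x → x *Q 1Q ≡ x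
  *Q-identityʳ x = trans ([_]-resp-≈ (~-· ~-refl rep[ _ ] ⟨~⟩ ~-*-identityʳ (rep x))) ([rep] x)

  *Q-distribˡ : ∀ x y z → x *Q (y +Q z) ≡ x *Q y +Q x *Q z
  *Q-distribˡ x y z = [_]-resp-≈
    (~-· ~-refl rep[ _ ] ⟨~⟩ ~-distribˡ (rep x) (rep y) (rep z)
     ⟨~⟩ ~-⊕ (~-sym rep[ _ ]) (~-sym rep[ _ ]))

  *Q-distribʳ : ∀ x y z → (y +Q z) *Q x ≡ y *Q x +Q z *Q x
  *Q-distribʳ x y z = [_]-resp-≈
    (~-· rep[ _ ] ~-refl ⟨~⟩ ~-distribʳ (rep x) (rep y) (rep z)
     ⟨~⟩ ~-⊕ (~-sym rep[ _ ]) (~-sym rep[ _ ]))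

  *Q-zeroˡ : ∀ x → 0Q *Q x ≡ 0Q
  *Q-zeroˡ x = [_]-resp-≈ (~-· rep[ _ ] ~-refl ⟨~⟩ ~-zeroˡ (rep x))

  *Q-zeroʳ : ∀ x → x *Q 0Q ≡ 0Q
  *Q-zeroʳ x = [_]-resp-≈ (~-· ~-refl rep[ _ ] ⟨~⟩ ~-zeroʳ (rep x))

  isSemiring : IsSemiring _≡_ _+Q_ _*Q_ 0Q 1Q
  isSemiring = record
    { isSemiringWithoutAnnihilatingZero = record
      { +-isCommutativeMonoid = record
        { isMonoid = record
          { isSemigroup = record
            { isMagma = record { isEquivalence = isEquivalence ; ∙-cong = cong₂ _+Q_ }
            ; assoc   = +Q-assoc
            }
          ; identity = +Q-identityˡ , +Q-identityʳ
          }
        ; comm = +Q-comm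
        }
      ; *-cong     = cong₂ _*Q_
      ; *-assoc    = *Q-assoc
      ; *-identity = *Q-identityˡ , *Q-identityʳ
      ; distrib    = *Q-distribˡ , *Q-distribʳ
      }
    ; zero = *Q-zeroˡ , *Q-zeroʳ
    }

  J : Carrier → FmlG Carrier → Set
  J a A = Γ (rep a ∶ mapF rep A)

  J-app : ∀ {s t A B} → J s (A ⇒ B) → J t A → J (s *Q t) B
  J-app {s} {t} {A} {B} Js Jt =
    Γ-⊑ (⊑-∶ _ (~-sym rep[ _ ]))
        (modus-ponens (modus-ponens (theorem (⊢-j (rep s) (rep t) _ _)) Js) Jt)

  J-sum : ∀ {s t A} → J s A → J t A → J (s +Q t) A
  J-sum {s} {t} Js Jt =
    Γ-⊑ (⊑-∶ _ (~-sym rep[ _ ])) (modus-ponens (theorem (⊢-j+ (rep s) (rep t) _)) (Γ-∧-intro Js Jt))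

  model : SemiringModel
  model = record
    { S = Carrier ; _+ₛ_ = _+Q_ ; _*ₛ_ = _*Q_ ; 0ₛ = 0Q ; 1ₛ = 1Q ; isSemiring = isSemiring
    ; star = λ p → does (em {Γ (atom p)})
    ; I = λ k → [ con k ] ; I-0 = refl ; I-1 = refl
    ; J = J ; J-app = λ {s t A B} → J-app {s} {t} {A} {B} ; J-sum = λ {s t A} → J-sum {s} {t} {A}
    }

  star-correct : ∀ p → (does (em {Γ (atom p)}) ≡ true) ⇔ Γ (atom p)
  star-correct p with em {Γ (atom p)}
  ... | yes Γp  = mk⇔ (λ _ → Γp) (λ _ → refl)
  ... | no  ¬Γp = mk⇔ (λ ()) (⊥-elim ∘ ¬Γp)

  module _ (v : JVar → Carrier) where
    private
      σ : Subst
      σ = rep ∘ v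

    ⟦⟧-[⟪⟫ᵗ] : ∀ t → ⟦_⟧ model t v ≡ [ t ⟪ σ ⟫ᵗ ]
    ⟦⟧-[⟪⟫ᵗ] (con k) = refl
    ⟦⟧-[⟪⟫ᵗ] (var x) = sym ([rep] (v x))
    ⟦⟧-[⟪⟫ᵗ] (s · t) = trans (cong₂ _*Q_ (⟦⟧-[⟪⟫ᵗ] s) (⟦⟧-[⟪⟫ᵗ] t)) ([]-*Q _ _)
    ⟦⟧-[⟪⟫ᵗ] (s ⊕ t) = trans (cong₂ _+Q_ (⟦⟧-[⟪⟫ᵗ] s) (⟦⟧-[⟪⟫ᵗ] t)) ([]-+Q _ _)

    J-⟦⟧ : ∀ t A → Sat model v (t ∶ A) ≡ Γ (mapF canon ((t ∶ A) ⟪ σ ⟫))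
    J-⟦⟧ t A = cong₂ (λ a B → Γ (a ∶ B)) (cong rep (⟦⟧-[⟪⟫ᵗ] t))
      (trans (mapF-∘ rep _ A) (trans (mapF-cong (cong rep ∘ ⟦⟧-[⟪⟫ᵗ]) A) (sym (mapF-∘ canon _ A))))

    truth : ∀ A → Sat model v A ⇔ Γ (A ⟪ σ ⟫)
    truth ⊥'       = mk⇔ ⊥-elim consistent
    truth (atom p) = star-correct p
    truth (A ⇒ B)  = mk⇔ (λ SatA⇒B → Γ-⇒-intro (to (truth B) ∘ SatA⇒B ∘ from (truth A)))
                         (λ ΓA⇒B → from (truth B) ∘ modus-ponens ΓA⇒B ∘ to (truth A))
    truth (t ∶ A)  = subst (_⇔ Γ ((t ∶ A) ⟪ σ ⟫)) (sym (J-⟦⟧ t A)) (Γ-mapF canon-≈ ((t ∶ A) ⟪ σ ⟫))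

  validTheory : ∀ A → T A → Valid model A
  validTheory A A∈T v = from (truth v A) (theorem (⊢-⟪⟫ A (rep ∘ v) (hyp A∈T)))

  valid⇒Γ : ∀ {A} → Valid model A → Γ A
  valid⇒Γ {A} ⊩A =
    to (Γ-mapF (⟪⟫ᵗ-~ (λ i → rep[ var i ])) A) (to (truth (λ i → [ var i ]) A) (⊩A _))

mainTheorem2 : ExcludedMiddle 0ℓ → (T : Theory) (F : Fml) → T ⊩ F → T ⊢ F
mainTheorem2 em T F ⊩F with em {T ⊢ F}
... | yes ⊢F = ⊢F
... | no  ⊬F = ⊥-elim (consistent (modus-ponens ¬F∈Γ F∈Γ))
  where
  open Provability T
  open Lindenbaum em (¬' F) (λ ⊢¬¬F → ⊬F (mp (⊢-taut (taut-dne F)) ⊢¬¬F))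
  open MaximalConsistent maximalConsistent using (consistent; modus-ponens)
  open CanonicalModel em maximalConsistent using (model; validTheory; valid⇒Γ)

  ¬F∈Γ : Γ (¬' F)
  ¬F∈Γ = C-in-Γ

  F∈Γ : Γ F
  F∈Γ = valid⇒Γ (⊩F model validTheory)
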